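{- Let $n$ be an odd positive integer with prime factorization $n=p_1^{a_1}\cdots p_k^{a_k}$, where $p_1<\cdots<p_k$ are distinct primes and each $a_i\ge 1$. Suppose that $\sigma(p_i^{a_i})$ is prime for every $1\le i\le k$, and that $n$ is near superperfect, i.e. $2n+d=\sigma(\sigma(n))$ for some positive divisor $d$ of $n$. Then $k\ge 3$. Moreover, if $k=3$, $k=4$ or $k=5$, then $p_1=3$.
   Context: $\sigma(m)$ denotes the sum of the positive divisors of the positive integer $m$. -}

module Defs where

open import Data.Nat using (ℕ; suc; _+_; _*_; _^_; _<_; _≤_)
open import Data.Nat.Divisibility using (_∣_; _∣?_)
open import Data.Nat.Primality using (Prime)
open import Data.List using (List; filter; applyUpTo; map)
open import Data.Nat.ListAction using (sum; product)
open import Data.List.Relation.Unary.All using (All)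
open import Data.List.Relation.Unary.Linked using (Linked)
open import Data.Product using (_×_; _,_; proj₁; proj₂; ∃)
open import Relation.Binary.PropositionalEquality using (_≡_)

σ : ℕ → ℕ
σ m = sum (filter (_∣? m) (applyUpTo suc m))

ppow : ℕ × ℕ → ℕ
ppow (p , a) = p ^ a

IsPrimeFactorization : ℕ → List (ℕ × ℕ) → Set
IsPrimeFactorization n fs =
  Linked (λ x y → proj₁ x < proj₁ y) fs
  × All (λ pa → Prime (proj₁ pa) × 1 ≤ proj₂ pa) fs
  × n ≡ product (map ppow fs)

NearSuperperfect : ℕ → Set
NearSuperperfect n = ∃ λ d → 1 ≤ d × d ∣ n × 2 * n + d ≡ σ (σ n)

{-# OPTIONS --safe #-}
module Submission where

-- Write qᵢ = σ(pᵢ^aᵢ), a prime by hypothesis. As pᵢ is odd, aᵢ = 1 would make σ(pᵢ) = pᵢ + 1 an even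
-- prime, so every aᵢ ≥ 2. Since σ is multiplicative, σ(n) = ∏ qᵢ, hence σ(σ(n)) ≤ ∏ (qᵢ + 1) and
-- near-superperfection gives 2 < ∏ (qᵢ + 1) / pᵢ^aᵢ. For a ≥ 2 we have (σ(p^a) + 1) / p^a ≤ 1 + 1/p + 2/p²,
-- which decreases in p, so any lower bounds cᵢ ≤ pᵢ give 2 < ∏ (cᵢ² + cᵢ + 2) / cᵢ². The odd primes
-- satisfy p₁ ≥ 3, p₂ ≥ 5, and if p₁ ≠ 3 then pᵢ ≥ 5, 7, 11, 13, 17; for these bounds the product is
-- below 2 as long as k ≤ 2, respectively k ≤ 5.

open import Defs
open import Data.Nat
open import Data.Nat.Properties
open import Data.Nat.Divisibility
open import Data.Nat.DivMod using (_/_; m/n*n≡m; m*[n/m]≡n)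
open import Data.Nat.GCD using (gcd; gcd[m,n]∣m; gcd[m,n]∣n; gcd[m,n]≢0)
open import Data.Nat.Coprimality as Coprime using (Coprime; coprime-divisor; coprime-/gcd; prime⇒coprime)
open import Data.Nat.Primality using (Prime; prime?; prime[2]; prime⇒nonZero; prime⇒nonTrivial; prime⇒irreducible)
open import Data.Nat.ListAction using (sum; product)
open import Data.Nat.ListAction.Properties using (sum-++; product-++; product≢0)
open import Data.Nat.Tactic.RingSolver using (solve-∀)
open import Data.List using (List; []; _∷_; _++_; map; filter; applyUpTo; cartesianProductWith; length)
open import Data.List.Properties using (map-++; length-map)
open import Data.List.Membership.Propositional using (_∈_)
open import Data.List.Membership.Propositional.Properties
  using (∈-∃++; ∈-++⁻; ∈-++⁺ˡ; ∈-++⁺ʳ; ∈-map⁺; ∈-map⁻; ∈-filter⁺; ∈-filter⁻; ∈-applyUpTo⁺; ∈-applyUpTo⁻;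
         ∈-cartesianProductWith⁺; ∈-cartesianProductWith⁻)
open import Data.List.Relation.Binary.Subset.Propositional using (_⊆_)
open import Data.List.Relation.Binary.Disjoint.Propositional using (Disjoint)
open import Data.List.Relation.Binary.Pointwise using (Pointwise; []; _∷_)
open import Data.List.Relation.Binary.Prefix.Heterogeneous as Prefix using (Prefix; []; _∷_; toView)
open import Data.List.Relation.Unary.All as All using (All; []; _∷_)
import Data.List.Relation.Unary.All.Properties as Allₚ
open import Data.List.Relation.Unary.AllPairs using (AllPairs; []; _∷_)
open import Data.List.Relation.Unary.Any using (here; there)
import Data.List.Relation.Unary.Linked.Properties as Linked
open import Data.List.Relation.Unary.Unique.Propositional using (Unique)
import Data.List.Relation.Unary.Unique.Propositional.Properties as Unique
open import Data.Product using (_×_; _,_; proj₁; proj₂; ∃-syntax; ∃₂)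
open import Data.Sum using (inj₁; inj₂)
open import Data.Unit using (⊤; tt)
open import Data.Empty using (⊥; ⊥-elim)
open import Function using (_∘_)
open import Relation.Nullary using (¬_; Dec; yes; no; ¬?; contradiction)
open import Relation.Nullary.Decidable using (True; False; toWitness; toWitnessFalse; _×-dec_)
open import Relation.Binary.PropositionalEquality
import Algebra.Properties.CommutativeSemigroup +-commutativeSemigroup as +-CS
import Algebra.Properties.CommutativeSemigroup *-commutativeSemigroup as *-CS

private
  variable
    A B C : Set

prime>1 : ∀ {p} → Prime p → 1 < p
prime>1 {p} pp = nonTrivial⇒n>1 p {{prime⇒nonTrivial pp}}

prime∣prime⇒≡ : ∀ {p q} → Prime p → Prime q → p ∣ q → p ≡ q
prime∣prime⇒≡ pp qq p∣q with prime⇒irreducible qq p∣q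
... | inj₁ p≡1 = contradiction p≡1 (nonTrivial⇒≢1 {{prime⇒nonTrivial pp}})
... | inj₂ p≡q = p≡q

oddPrime>2 : ∀ {p} → Prime p → ¬ 2 ∣ p → 2 < p
oddPrime>2 pp p-odd = ≤∧≢⇒< (prime>1 pp) (λ 2≡p → p-odd (subst (2 ∣_) 2≡p ∣-refl))

¬2∣⇒2∣suc : ∀ {m} → ¬ 2 ∣ m → 2 ∣ suc m
¬2∣⇒2∣suc {zero}        m-odd = contradiction (2 ∣0) m-odd
¬2∣⇒2∣suc {suc zero}    _     = ∣-refl
¬2∣⇒2∣suc {suc (suc m)} m-odd = ∣m∣n⇒∣m+n ∣-refl (¬2∣⇒2∣suc (m-odd ∘ ∣m∣n⇒∣m+n ∣-refl))

sum-mono-⊆ : ∀ {xs ys} → Unique xs → xs ⊆ ys → sum xs ≤ sum ys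
sum-mono-⊆ {[]} _ _ = z≤n
sum-mono-⊆ {x ∷ xs} (x∉xs ∷ xs!) xs⊆ys with ys₁ , ys₂ , refl ← ∈-∃++ (xs⊆ys (here refl)) = begin
  x + sum xs               ≤⟨ +-monoʳ-≤ x (sum-mono-⊆ xs! xs⊆ys₁++ys₂) ⟩
  x + sum (ys₁ ++ ys₂)     ≡⟨ cong (x +_) (sum-++ ys₁ ys₂) ⟩
  x + (sum ys₁ + sum ys₂)  ≡⟨ +-CS.x∙yz≈y∙xz x (sum ys₁) (sum ys₂) ⟩
  sum ys₁ + (x + sum ys₂)  ≡⟨ sum-++ ys₁ (x ∷ ys₂) ⟨
  sum (ys₁ ++ x ∷ ys₂)     ∎
  where
  open ≤-Reasoning
  xs⊆ys₁++ys₂ : xs ⊆ ys₁ ++ ys₂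
  xs⊆ys₁++ys₂ y∈xs with ∈-++⁻ ys₁ (xs⊆ys (there y∈xs))
  ... | inj₁ y∈ys₁         = ∈-++⁺ˡ y∈ys₁
  ... | inj₂ (here refl)   = contradiction refl (All.lookup x∉xs y∈xs)
  ... | inj₂ (there y∈ys₂) = ∈-++⁺ʳ ys₁ y∈ys₂

sum-map-*ˡ : ∀ m ns → sum (map (m *_) ns) ≡ m * sum ns
sum-map-*ˡ m []       = sym (*-zeroʳ m)
sum-map-*ˡ m (n ∷ ns) = trans (cong (m * n +_) (sum-map-*ˡ m ns)) (sym (*-distribˡ-+ m n (sum ns)))

sum-cartesianProductWith-* : ∀ xs ys → sum (cartesianProductWith _*_ xs ys) ≡ sum xs * sum ys
sum-cartesianProductWith-* []       ys = refl
sum-cartesianProductWith-* (x ∷ xs) ys = begin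
  sum (map (x *_) ys ++ cartesianProductWith _*_ xs ys)       ≡⟨ sum-++ (map (x *_) ys) _ ⟩
  sum (map (x *_) ys) + sum (cartesianProductWith _*_ xs ys)  ≡⟨ cong₂ _+_ (sum-map-*ˡ x ys) (sum-cartesianProductWith-* xs ys) ⟩
  x * sum ys + sum xs * sum ys                                ≡⟨ *-distribʳ-+ (sum ys) x (sum xs) ⟨
  (x + sum xs) * sum ys                                       ∎
  where open ≡-Reasoning

unique-map⁺ : ∀ {f : A → B} {xs} → (∀ {x y} → x ∈ xs → y ∈ xs → f x ≡ f y → x ≡ y) →
              Unique xs → Unique (map f xs)
unique-map⁺ {xs = []}     _   []           = []
unique-map⁺ {xs = x ∷ xs} inj (x∉xs ∷ xs!) =
  Allₚ.map⁺ (All.tabulate λ y∈xs fx≡fy → All.lookup x∉xs y∈xs (inj (here refl) (there y∈xs) fx≡fy))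
  ∷ unique-map⁺ (λ x∈ y∈ → inj (there x∈) (there y∈)) xs!

unique-cartesianProductWith⁺ : ∀ (f : A → B → C) {xs ys} →
  (∀ {w x y z} → w ∈ xs → x ∈ xs → y ∈ ys → z ∈ ys → f w y ≡ f x z → w ≡ x × y ≡ z) →
  Unique xs → Unique ys → Unique (cartesianProductWith f xs ys)
unique-cartesianProductWith⁺ f {[]}     _   []           _   = []
unique-cartesianProductWith⁺ f {x ∷ xs} {ys} inj (x∉xs ∷ xs!) ys! =
  Unique.++⁺ (unique-map⁺ (λ y∈ z∈ → proj₂ ∘ inj (here refl) (here refl) y∈ z∈) ys!)
             (unique-cartesianProductWith⁺ f (λ w∈ x∈ → inj (there w∈) (there x∈)) xs! ys!)
             disjoint
  where
  disjoint : Disjoint (map (f x) ys) (cartesianProductWith f xs ys)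
  disjoint (v∈fx[ys] , v∈f[xs,ys]) with y , y∈ys , refl ← ∈-map⁻ (f x) v∈fx[ys]
                                      | w , z , w∈xs , z∈ys , fxy≡fwz ← ∈-cartesianProductWith⁻ f xs ys v∈f[xs,ys]
    = All.lookup x∉xs w∈xs (proj₁ (inj (here refl) (there w∈xs) y∈ys z∈ys fxy≡fwz))

-- Divisor sums

divisors : ℕ → List ℕ
divisors m = filter (_∣? m) (applyUpTo suc m)

divisors-unique : ∀ m → Unique (divisors m)
divisors-unique m = Unique.filter⁺ (_∣? m) (Unique.applyUpTo⁺₁ suc m (λ i<j _ → <⇒≢ i<j ∘ suc-injective))

∈-divisors⁺ : ∀ {m d} .{{_ : NonZero m}} → d ∣ m → d ∈ divisors m
∈-divisors⁺ {m} {zero}  0∣m = contradiction (0∣⇒≡0 0∣m) (≢-nonZero⁻¹ m)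
∈-divisors⁺ {m} {suc d} d∣m = ∈-filter⁺ (_∣? m) (∈-applyUpTo⁺ suc (∣⇒≤ d∣m)) d∣m

∈-divisors⁻ : ∀ {m d} → d ∈ divisors m → d ∣ m
∈-divisors⁻ {m} d∈ = proj₂ (∈-filter⁻ (_∣? m) {xs = applyUpTo suc m} d∈)

∈-divisors⇒nonZero : ∀ {m d} → d ∈ divisors m → NonZero d
∈-divisors⇒nonZero {m} d∈
  with _ , _ , refl ← ∈-applyUpTo⁻ suc (proj₁ (∈-filter⁻ (_∣? m) {xs = applyUpTo suc m} d∈)) = _

σ≤sum : ∀ {m ds} → (∀ {d} → d ∣ m → d ∈ ds) → σ m ≤ sum ds
σ≤sum {m} covers = sum-mono-⊆ (divisors-unique m) (λ d∈ → covers (∈-divisors⁻ d∈))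

sum≤σ : ∀ {m ds} .{{_ : NonZero m}} → Unique ds → (∀ {d} → d ∈ ds → d ∣ m) → sum ds ≤ σ m
sum≤σ ds! divide = sum-mono-⊆ ds! (λ d∈ → ∈-divisors⁺ (divide d∈))

σ-prime : ∀ {p} → Prime p → σ p ≡ suc p
σ-prime {p} pp =
  trans (≤-antisym (σ≤sum 1-or-p) (sum≤σ {{prime⇒nonZero pp}} 1,p-unique 1,p-divide)) (cong suc (+-identityʳ p))
  where
  1-or-p : ∀ {d} → d ∣ p → d ∈ 1 ∷ p ∷ []
  1-or-p d∣p with prime⇒irreducible pp d∣p
  ... | inj₁ refl = here refl
  ... | inj₂ refl = there (here refl)
  1,p-unique : Unique (1 ∷ p ∷ [])
  1,p-unique = (<⇒≢ (prime>1 pp) ∷ []) ∷ [] ∷ []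
  1,p-divide : ∀ {d} → d ∈ 1 ∷ p ∷ [] → d ∣ p
  1,p-divide (here refl)         = 1∣ p
  1,p-divide (there (here refl)) = ∣-refl

∣p^a⇒≡p^j : ∀ {p d} → Prime p → ∀ a → d ∣ p ^ a → ∃[ j ] j ≤ a × d ≡ p ^ j
∣p^a⇒≡p^j pp zero d∣1 = 0 , z≤n , ∣1⇒≡1 d∣1
∣p^a⇒≡p^j {p} {d} pp (suc a) d∣p^1+a with p ∣? d
... | yes (divides e refl) =
  let j , j≤a , e≡p^j = ∣p^a⇒≡p^j pp a e∣p^a in suc j , s≤s j≤a , trans (*-comm e p) (cong (p *_) e≡p^j)
  where
  e∣p^a : e ∣ p ^ a
  e∣p^a = *-cancelʳ-∣ p {{prime⇒nonZero pp}} (subst (e * p ∣_) (*-comm p (p ^ a)) d∣p^1+a)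
... | no p∤d =
  let j , j≤a , d≡p^j = ∣p^a⇒≡p^j pp a (coprime-divisor d⊥p d∣p^1+a) in j , m≤n⇒m≤1+n j≤a , d≡p^j
  where
  d⊥p : Coprime d p
  d⊥p (c∣d , c∣p) with prime⇒irreducible pp c∣p
  ... | inj₁ c≡1 = c≡1
  ... | inj₂ refl = contradiction c∣d p∤d

powers : ℕ → ℕ → List ℕ
powers p zero    = 1 ∷ []
powers p (suc a) = 1 ∷ map (p *_) (powers p a)

^∈powers : ∀ p {a j} → j ≤ a → p ^ j ∈ powers p a
^∈powers p {zero}  {zero}  _         = here refl
^∈powers p {suc a} {zero}  _         = here refl
^∈powers p {suc a} {suc j} (s≤s j≤a) = there (∈-map⁺ (p *_) (^∈powers p j≤a))

sum-powers : ∀ p a → sum (powers p (suc a)) ≡ suc (p * sum (powers p a))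
sum-powers p a = cong suc (sum-map-*ˡ p (powers p a))

σ[p^a]≤sum-powers : ∀ {p} a → Prime p → σ (p ^ a) ≤ sum (powers p a)
σ[p^a]≤sum-powers {p} a pp = σ≤sum λ d∣p^a →
  let j , j≤a , d≡p^j = ∣p^a⇒≡p^j pp a d∣p^a in subst (_∈ powers p a) (sym d≡p^j) (^∈powers p j≤a)

sum-powers-bound : ∀ {p} a → 2 ≤ p → 2 ≤ a → (sum (powers p a) + 1) * (p * p) ≤ (p * p + p + 2) * p ^ a
sum-powers-bound 1 _ (s≤s ())
sum-powers-bound {p} 2 _ _ = ≤-reflexive (equality p)
  where
  equality : ∀ p → (1 + (p * 1 + (p * (p * 1) + 0)) + 1) * (p * p) ≡ (p * p + p + 2) * (p * (p * 1))
  equality = solve-∀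
sum-powers-bound {p} (suc a@(suc (suc _))) 2≤p _ = begin
  (sum (powers p (suc a)) + 1) * (p * p)  ≡⟨ cong (λ s → (s + 1) * (p * p)) (sum-powers p a) ⟩
  (suc (p * S) + 1) * (p * p)             ≡⟨ regroup-left p S ⟩
  (2 + p * S) * (p * p)                   ≤⟨ *-monoˡ-≤ (p * p) (+-monoˡ-≤ (p * S) 2≤p) ⟩
  (p + p * S) * (p * p)                   ≡⟨ regroup-right p S ⟩
  p * ((S + 1) * (p * p))                 ≤⟨ *-monoʳ-≤ p (sum-powers-bound a 2≤p (s≤s (s≤s z≤n))) ⟩
  p * ((p * p + p + 2) * p ^ a)           ≡⟨ *-CS.x∙yz≈y∙xz p (p * p + p + 2) (p ^ a) ⟩
  (p * p + p + 2) * p ^ suc a             ∎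
  where
  open ≤-Reasoning
  S = sum (powers p a)
  regroup-left : ∀ p S → (suc (p * S) + 1) * (p * p) ≡ (2 + p * S) * (p * p)
  regroup-left = solve-∀
  regroup-right : ∀ p S → (p + p * S) * (p * p) ≡ p * ((S + 1) * (p * p))
  regroup-right = solve-∀

-- Multiplicativity of σ

coprime-∣ : ∀ {m n d e} → Coprime m n → d ∣ m → e ∣ n → Coprime d e
coprime-∣ m⊥n d∣m e∣n (c∣d , c∣e) = m⊥n (∣-trans c∣d d∣m , ∣-trans c∣e e∣n)

coprime-* : ∀ {m n o} → Coprime m n → Coprime m o → Coprime m (n * o)
coprime-* m⊥n m⊥o (c∣m , c∣no) = m⊥o (c∣m , coprime-divisor (coprime-∣ m⊥n c∣m ∣-refl) c∣no)

coprime-^ʳ : ∀ {m n} → Coprime m n → ∀ b → Coprime m (n ^ b)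
coprime-^ʳ _   zero    (_ , c∣1) = ∣1⇒≡1 c∣1
coprime-^ʳ m⊥n (suc b) = coprime-* m⊥n (coprime-^ʳ m⊥n b)

coprime-^ : ∀ {m n} → Coprime m n → ∀ a b → Coprime (m ^ a) (n ^ b)
coprime-^ m⊥n a b = Coprime.sym (coprime-^ʳ (Coprime.sym (coprime-^ʳ m⊥n b)) a)

coprime-product : ∀ {m ns} → All (Coprime m) ns → Coprime m (product ns)
coprime-product []           (_ , c∣1) = ∣1⇒≡1 c∣1
coprime-product (m⊥n ∷ m⊥ns) = coprime-* m⊥n (coprime-product m⊥ns)

coprime-*-injective : ∀ {m n w x y z} → Coprime m n → w ∣ m → x ∣ m → y ∣ n → z ∣ n → .{{_ : NonZero w}} →
                      w * y ≡ x * z → w ≡ x × y ≡ z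
coprime-*-injective {w = w} {x} {y} {z} m⊥n w∣m x∣m y∣n z∣n wy≡xz =
  w≡x , *-cancelˡ-≡ y z w (trans wy≡xz (cong (_* z) (sym w≡x)))
  where
  w∣x : w ∣ x
  w∣x = coprime-divisor (coprime-∣ m⊥n w∣m z∣n) (subst (w ∣_) (trans wy≡xz (*-comm x z)) (m∣m*n y))
  x∣w : x ∣ w
  x∣w = coprime-divisor (coprime-∣ m⊥n x∣m y∣n) (subst (x ∣_) (trans (sym wy≡xz) (*-comm w y)) (m∣m*n z))
  w≡x : w ≡ x
  w≡x = ∣-antisym w∣x x∣w

-- With g = gcd d m, the quotients d / g and m / g are coprime, so d / g ∣ (m / g) * n forces d / g ∣ n.
∣m*n⇒∣m*∣n : ∀ {d} m n .{{_ : NonZero m}} → d ∣ m * n → ∃₂ λ d₁ d₂ → d₁ ∣ m × d₂ ∣ n × d ≡ d₁ * d₂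
∣m*n⇒∣m*∣n {d} m n d∣mn = g , d / g , g∣m , d/g∣n , sym (m*[n/m]≡n g∣d)
  where
  g = gcd d m
  instance
    g≢0 : NonZero g
    g≢0 = ≢-nonZero (gcd[m,n]≢0 d m (inj₂ (≢-nonZero⁻¹ m)))
  g∣d : g ∣ d
  g∣d = gcd[m,n]∣m d m
  g∣m : g ∣ m
  g∣m = gcd[m,n]∣n d m
  mn≡m/g*n*g : m * n ≡ m / g * n * g
  mn≡m/g*n*g = trans (cong (_* n) (sym (m/n*n≡m g∣m))) (*-CS.xy∙z≈xz∙y (m / g) g n)
  d/g∣n : d / g ∣ n
  d/g∣n = coprime-divisor (coprime-/gcd d m) (*-cancelʳ-∣ g (subst₂ _∣_ (sym (m/n*n≡m g∣d)) mn≡m/g*n*g d∣mn))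

σ-submultiplicative : ∀ m n → σ (m * n) ≤ σ m * σ n
σ-submultiplicative zero    n    = z≤n
σ-submultiplicative (suc m) zero rewrite *-zeroʳ m = z≤n
σ-submultiplicative m@(suc _) n@(suc _) =
  subst (σ (m * n) ≤_) (sum-cartesianProductWith-* (divisors m) (divisors n)) (σ≤sum {m * n} covered)
  where
  covered : ∀ {d} → d ∣ m * n → d ∈ cartesianProductWith _*_ (divisors m) (divisors n)
  covered d∣mn with d₁ , d₂ , d₁∣m , d₂∣n , refl ← ∣m*n⇒∣m*∣n m n d∣mn =
    ∈-cartesianProductWith⁺ _*_ (∈-divisors⁺ {m} d₁∣m) (∈-divisors⁺ {n} d₂∣n)

σ-multiplicative : ∀ {m n} → Coprime m n → σ (m * n) ≡ σ m * σ n
σ-multiplicative {zero}  _ = refl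
σ-multiplicative {suc m} {zero} _ rewrite *-zeroʳ m | *-zeroʳ (σ (suc m)) = refl
σ-multiplicative {m@(suc _)} {n@(suc _)} m⊥n = ≤-antisym (σ-submultiplicative m n)
  (subst (_≤ σ (m * n)) (sum-cartesianProductWith-* (divisors m) (divisors n)) (sum≤σ {m * n} products-unique products-divide))
  where
  injective : ∀ {w x y z} → w ∈ divisors m → x ∈ divisors m → y ∈ divisors n → z ∈ divisors n →
              w * y ≡ x * z → w ≡ x × y ≡ z
  injective w∈ x∈ y∈ z∈ =
    coprime-*-injective m⊥n (∈-divisors⁻ {m} w∈) (∈-divisors⁻ {m} x∈) (∈-divisors⁻ {n} y∈) (∈-divisors⁻ {n} z∈)
                        {{∈-divisors⇒nonZero {m} w∈}}
  products-unique : Unique (cartesianProductWith _*_ (divisors m) (divisors n))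
  products-unique = unique-cartesianProductWith⁺ _*_ injective (divisors-unique m) (divisors-unique n)
  products-divide : ∀ {d} → d ∈ cartesianProductWith _*_ (divisors m) (divisors n) → d ∣ m * n
  products-divide d∈ with d₁ , d₂ , d₁∈ , d₂∈ , refl ← ∈-cartesianProductWith⁻ _*_ (divisors m) (divisors n) d∈ =
    *-pres-∣ (∈-divisors⁻ {m} d₁∈) (∈-divisors⁻ {n} d₂∈)

σ-product-prime-powers : ∀ {fs} → AllPairs (λ x y → proj₁ x < proj₁ y) fs → All (Prime ∘ proj₁) fs →
                         σ (product (map ppow fs)) ≡ product (map (σ ∘ ppow) fs)
σ-product-prime-powers []                   []           = refl
σ-product-prime-powers {(p , a) ∷ fs} (p<fs ∷ increasing) (pp ∷ primes) = begin
  σ (p ^ a * product (map ppow fs))        ≡⟨ σ-multiplicative (coprime-product p^a⊥rest) ⟩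
  σ (p ^ a) * σ (product (map ppow fs))    ≡⟨ cong (σ (p ^ a) *_) (σ-product-prime-powers increasing primes) ⟩
  σ (p ^ a) * product (map (σ ∘ ppow) fs)  ∎
  where
  open ≡-Reasoning
  coprime : ∀ {qb} → p < proj₁ qb × Prime (proj₁ qb) → Coprime (p ^ a) (ppow qb)
  coprime {qb} (p<q , qq) = coprime-^ (Coprime.sym (prime⇒coprime qq {{prime⇒nonZero pp}} p<q)) a (proj₂ qb)
  p^a⊥rest : All (Coprime (p ^ a)) (map ppow fs)
  p^a⊥rest = Allₚ.map⁺ (All.zipWith (λ {qb} → coprime {qb}) (p<fs , primes))

σ-product-primes : ∀ {qs} → All Prime qs → σ (product qs) ≤ product (map (_+ 1) qs)
σ-product-primes []                 = ≤-refl
σ-product-primes {q ∷ qs} (qq ∷ qqs) = begin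
  σ (q * product qs)                 ≤⟨ σ-submultiplicative q (product qs) ⟩
  σ q * σ (product qs)               ≤⟨ *-mono-≤ (≤-reflexive (trans (σ-prime qq) (+-comm 1 q))) (σ-product-primes qqs) ⟩
  (q + 1) * product (map (_+ 1) qs)  ∎
  where open ≤-Reasoning

-- The ratio bound

ratioNum ratioDen : List ℕ → ℕ
ratioNum cs = product (map (λ c → c * c + c + 2) cs)
ratioDen cs = product (map (λ c → c * c) cs)

ratio-antitone : ∀ {c p} → c ≤ p → (p * p + p + 2) * (c * c) ≤ (c * c + c + 2) * (p * p)
ratio-antitone {c} {p} c≤p = begin
  (p * p + p + 2) * (c * c)                      ≡⟨ expand-left c p ⟩
  c * c * (p * p) + (c * (c * p) + 2 * (c * c))  ≤⟨ +-monoʳ-≤ (c * c * (p * p)) (+-mono-≤ cp≤pp 2cc≤2pp) ⟩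
  c * c * (p * p) + (c * (p * p) + 2 * (p * p))  ≡⟨ expand-right c p ⟨
  (c * c + c + 2) * (p * p)                      ∎
  where
  open ≤-Reasoning
  cp≤pp = *-monoʳ-≤ c (*-monoˡ-≤ p c≤p)
  2cc≤2pp = *-monoʳ-≤ 2 (*-mono-≤ c≤p c≤p)
  expand-left : ∀ c p → (p * p + p + 2) * (c * c) ≡ c * c * (p * p) + (c * (c * p) + 2 * (c * c))
  expand-left = solve-∀
  expand-right : ∀ c p → (c * c + c + 2) * (p * p) ≡ c * c * (p * p) + (c * (p * p) + 2 * (p * p))
  expand-right = solve-∀

σ[p^a]-ratio : ∀ {p a c} → Prime p → 2 ≤ a → c ≤ p → (σ (p ^ a) + 1) * (c * c) ≤ (c * c + c + 2) * p ^ a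
σ[p^a]-ratio {p} {a} {c} pp 2≤a c≤p = *-cancelʳ-≤ _ _ (p * p) (begin
  (σ (p ^ a) + 1) * (c * c) * (p * p)  ≤⟨ *-monoˡ-≤ (p * p) (*-monoˡ-≤ (c * c) (+-monoˡ-≤ 1 (σ[p^a]≤sum-powers a pp))) ⟩
  (S + 1) * (c * c) * (p * p)          ≡⟨ *-CS.xy∙z≈xz∙y (S + 1) (c * c) (p * p) ⟩
  (S + 1) * (p * p) * (c * c)          ≤⟨ *-monoˡ-≤ (c * c) (sum-powers-bound a (prime>1 pp) 2≤a) ⟩
  (p * p + p + 2) * p ^ a * (c * c)    ≡⟨ *-CS.xy∙z≈xz∙y (p * p + p + 2) (p ^ a) (c * c) ⟩
  (p * p + p + 2) * (c * c) * p ^ a    ≤⟨ *-monoˡ-≤ (p ^ a) (ratio-antitone c≤p) ⟩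
  (c * c + c + 2) * (p * p) * p ^ a    ≡⟨ *-CS.xy∙z≈xz∙y (c * c + c + 2) (p * p) (p ^ a) ⟩
  (c * c + c + 2) * p ^ a * (p * p)    ∎)
  where
  open ≤-Reasoning
  S = sum (powers p a)
  instance
    p≢0 : NonZero p
    p≢0 = prime⇒nonZero pp
    p*p≢0 : NonZero (p * p)
    p*p≢0 = m*n≢0 p p

PowerfulPrimePower : ℕ × ℕ → Set
PowerfulPrimePower (p , a) = Prime p × 2 ≤ a

σ[p^a]-ratio-product : ∀ {fs cs} → All PowerfulPrimePower fs → Pointwise _≥_ (map proj₁ fs) cs →
               product (map (_+ 1) (map (σ ∘ ppow) fs)) * ratioDen cs ≤ ratioNum cs * product (map ppow fs)
σ[p^a]-ratio-product []                     []              = ≤-refl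
σ[p^a]-ratio-product {(p , a) ∷ fs} {c ∷ cs} ((pp , 2≤a) ∷ powerful) (c≤p ∷ bounds) = begin
  (σ (p ^ a) + 1) * X * (c * c * D)    ≡⟨ *-CS.interchange (σ (p ^ a) + 1) X (c * c) D ⟩
  (σ (p ^ a) + 1) * (c * c) * (X * D)  ≤⟨ *-mono-≤ (σ[p^a]-ratio pp 2≤a c≤p) (σ[p^a]-ratio-product powerful bounds) ⟩
  (c * c + c + 2) * p ^ a * (N * n)    ≡⟨ *-CS.interchange (c * c + c + 2) (p ^ a) N n ⟩
  (c * c + c + 2) * N * (p ^ a * n)    ∎
  where
  open ≤-Reasoning
  X = product (map (_+ 1) (map (σ ∘ ppow) fs))
  D = ratioDen cs
  N = ratioNum cs
  n = product (map ppow fs)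

RatioProduct>2 : List ℕ → Set
RatioProduct>2 ps = ∀ {cs} → Pointwise _≥_ ps cs → .{{NonZero (ratioDen cs)}} → 2 * ratioDen cs < ratioNum cs

excess⇒ratio>2 : ∀ {fs} → All PowerfulPrimePower fs →
                 2 * product (map ppow fs) < product (map (_+ 1) (map (σ ∘ ppow) fs)) →
                 RatioProduct>2 (map proj₁ fs)
excess⇒ratio>2 {fs} powerful 2n<X {cs} bounds = *-cancelʳ-< n _ _ (begin-strict
  2 * ratioDen cs * n                                     ≡⟨ *-CS.xy∙z≈xz∙y 2 (ratioDen cs) n ⟩
  2 * n * ratioDen cs                                     <⟨ *-monoˡ-< (ratioDen cs) 2n<X ⟩
  product (map (_+ 1) (map (σ ∘ ppow) fs)) * ratioDen cs  ≤⟨ σ[p^a]-ratio-product powerful bounds ⟩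
  ratioNum cs * n                                         ∎)
  where
  open ≤-Reasoning
  n = product (map ppow fs)

product-map-++ : ∀ (f : ℕ → ℕ) xs ys → product (map f (xs ++ ys)) ≡ product (map f xs) * product (map f ys)
product-map-++ f xs ys = trans (cong product (map-++ f xs ys)) (product-++ (map f xs) (map f ys))

ratio>2-++ : ∀ cs ds → 2 * ratioDen cs < ratioNum cs → 2 * ratioDen (cs ++ ds) < ratioNum (cs ++ ds)
ratio>2-++ cs ds 2D<N = begin-strict
  2 * ratioDen (cs ++ ds)          ≡⟨ cong (2 *_) (product-map-++ _ cs ds) ⟩
  2 * (ratioDen cs * ratioDen ds)  ≡⟨ *-assoc 2 (ratioDen cs) (ratioDen ds) ⟨
  2 * ratioDen cs * ratioDen ds    ≤⟨ *-monoʳ-≤ (2 * ratioDen cs) (den≤num ds) ⟩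
  2 * ratioDen cs * ratioNum ds    <⟨ *-monoˡ-< (ratioNum ds) {{num≢0 ds}} 2D<N ⟩
  ratioNum cs * ratioNum ds        ≡⟨ product-map-++ _ cs ds ⟨
  ratioNum (cs ++ ds)              ∎
  where
  open ≤-Reasoning
  den≤num : ∀ cs → ratioDen cs ≤ ratioNum cs
  den≤num []       = ≤-refl
  den≤num (c ∷ cs) = *-mono-≤ (≤-trans (m≤m+n (c * c) c) (m≤m+n (c * c + c) 2)) (den≤num cs)
  num≢0 : ∀ cs → NonZero (ratioNum cs)
  num≢0 cs = product≢0 (Allₚ.map⁺ (All.universal (λ c → ≢-nonZero (m+1+n≢0 (c * c + c))) cs))

refute : ∀ {ps cs} → RatioProduct>2 ps → Prefix _≥_ ps cs → .{{NonZero (ratioDen cs)}} →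
         {False (2 * ratioDen cs <? ratioNum cs)} → ⊥
refute ratio>2 prefix {{D≢0}} {ratio≤2} with Prefix._++_ {cs} bounds ds ← toView prefix =
  toWitnessFalse ratio≤2 (ratio>2-++ cs ds (ratio>2 bounds {{D₁≢0}}))
  where
  D₁≢0 = m*n≢0⇒m≢0 (ratioDen cs) {{subst NonZero (product-map-++ (λ c → c * c) cs ds) D≢0}}

-- Lower bounds for the primes

NoPrimeIn : ℕ → ℕ → Set
NoPrimeIn m zero    = ⊤
NoPrimeIn m (suc k) = ¬ Prime (suc m) × NoPrimeIn (suc m) k

noPrimeIn? : ∀ m k → Dec (NoPrimeIn m k)
noPrimeIn? m zero    = yes tt
noPrimeIn? m (suc k) = ¬? (prime? (suc m)) ×-dec noPrimeIn? (suc m) k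

prime-gap : ∀ m k {q} → NoPrimeIn m k → Prime q → m < q → k + suc m ≤ q
prime-gap m zero    _                        _  m<q = m<q
prime-gap m (suc k) {q} (¬prime[1+m] , no-prime) qq m<q =
  subst (_≤ q) (+-suc k (suc m)) (prime-gap (suc m) k no-prime qq 1+m<q)
  where
  1+m<q = ≤∧≢⇒< m<q (λ 1+m≡q → ¬prime[1+m] (subst Prime (sym 1+m≡q) qq))

next-prime-≥ : ∀ m k {_ : True (noPrimeIn? m k)} {q} → Prime q → m < q → k + suc m ≤ q
next-prime-≥ m k {no-prime} = prime-gap m k (toWitness no-prime)

Ladder : List ℕ → Set
Ladder (c ∷ c′ ∷ cs) = (∀ {q} → Prime q → c < q → c′ ≤ q) × Ladder (c′ ∷ cs)
Ladder _             = ⊤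

ladder-bounds : ∀ {c} cs {ps} → Ladder (c ∷ cs) → AllPairs _<_ (c ∷ ps) → All Prime ps →
                length ps ≤ length cs → Prefix _≥_ ps cs
ladder-bounds _         {[]}    _               _                                  _             _         = []
ladder-bounds []        {_ ∷ _} _               _                                  _             ()
ladder-bounds (_ ∷ cs)  {_ ∷ _} (step , ladder) ((c<q ∷ _) ∷ q<ps ∷ increasing) (qq ∷ primes) (s≤s len) =
  c′≤q ∷ ladder-bounds cs ladder (All.map (≤-<-trans c′≤q) q<ps ∷ increasing) primes len
  where
  c′≤q = step qq c<q

ladder₂ : Ladder (2 ∷ 3 ∷ 5 ∷ [])
ladder₂ = next-prime-≥ 2 0 , next-prime-≥ 3 1 , tt

ladder₃ : Ladder (3 ∷ 5 ∷ 7 ∷ 11 ∷ 13 ∷ 17 ∷ [])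
ladder₃ = next-prime-≥ 3 1 , next-prime-≥ 5 1 , next-prime-≥ 7 3 , next-prime-≥ 11 1 , next-prime-≥ 13 3 , tt

length≥3 : ∀ {ps} → AllPairs _<_ (2 ∷ ps) → All Prime ps → RatioProduct>2 ps → 3 ≤ length ps
length≥3 {ps} above2 primes ratio>2 with 3 ≤? length ps
... | yes 3≤k = 3≤k
... | no  3≰k = ⊥-elim (refute ratio>2 (ladder-bounds (3 ∷ 5 ∷ []) ladder₂ above2 primes (≤-pred (≰⇒> 3≰k))))

head≡3 : ∀ {ps p qs} → ps ≡ p ∷ qs → AllPairs _<_ (2 ∷ ps) → All Prime ps → RatioProduct>2 ps →
         length ps ≤ 5 → p ≡ 3
head≡3 {p = p} {qs} refl ((2<p ∷ _) ∷ p<qs ∷ increasing) primes ratio>2 k≤5 with p ≟ 3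
... | yes p≡3 = p≡3
... | no  p≢3 = ⊥-elim (refute ratio>2 (ladder-bounds (5 ∷ 7 ∷ 11 ∷ 13 ∷ 17 ∷ []) ladder₃ above3 primes k≤5))
  where
  3<p : 3 < p
  3<p = ≤∧≢⇒< 2<p (p≢3 ∘ sym)
  above3 : AllPairs _<_ (3 ∷ p ∷ qs)
  above3 = (3<p ∷ All.map (<-trans 3<p) p<qs) ∷ p<qs ∷ increasing

∤prime-powers⇒∤primes : ∀ {m fs} → ¬ m ∣ product (map ppow fs) → All (λ pa → 1 ≤ proj₂ pa) fs →
                        All (λ pa → ¬ m ∣ proj₁ pa) fs
∤prime-powers⇒∤primes {fs = []}                _   []          = []
∤prime-powers⇒∤primes {fs = (p , suc a) ∷ fs} m∤n (_ ∷ exps) =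
  (m∤n ∘ ∣m⇒∣m*n _ ∘ ∣m⇒∣m*n (p ^ a)) ∷ ∤prime-powers⇒∤primes (m∤n ∘ ∣n⇒∣m*n (p ^ suc a)) exps

exponent≥2 : ∀ {p} a → Prime p → ¬ 2 ∣ p → 1 ≤ a → Prime (σ (p ^ a)) → 2 ≤ a
exponent≥2 (suc (suc _)) _ _ _ _ = s≤s (s≤s z≤n)
exponent≥2 {p} 1 pp p-odd _ σ[p]-prime =
  contradiction (suc-injective 2≡1+p) (≢-sym (nonTrivial⇒≢1 {{prime⇒nonTrivial pp}}))
  where
  1+p-prime : Prime (suc p)
  1+p-prime = subst Prime (trans (cong σ (*-identityʳ p)) (σ-prime pp)) σ[p]-prime
  2≡1+p : 2 ≡ suc p
  2≡1+p = prime∣prime⇒≡ prime[2] 1+p-prime (¬2∣⇒2∣suc p-odd)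

mainTheorem1 : (n : ℕ) → (fs : List (ℕ × ℕ)) →
    1 ≤ n → ¬ (2 ∣ n) →
    IsPrimeFactorization n fs →
    All (λ pa → Prime (σ (ppow pa))) fs →
    NearSuperperfect n →
    3 ≤ length fs
      × ((p a : ℕ) → (rest : List (ℕ × ℕ)) → fs ≡ (p , a) ∷ rest →
          3 ≤ length fs → length fs ≤ 5 → p ≡ 3)
mainTheorem1 _ fs _ n-odd (increasing , factors , refl) σ-primes (d , d≥1 , _ , near-superperfect) =
  subst (3 ≤_) (length-map proj₁ fs) (length≥3 above2 primes ratio>2) ,
  λ p a rest fs≡ _ k≤5 →
    head≡3 (cong (map proj₁) fs≡) above2 primes ratio>2 (subst (_≤ 5) (sym (length-map proj₁ fs)) k≤5)
  where
  n = product (map ppow fs)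
  ps = map proj₁ fs
  primes : All Prime ps
  primes = Allₚ.map⁺ (All.map proj₁ factors)
  odd : All (λ pa → ¬ 2 ∣ proj₁ pa) fs
  odd = ∤prime-powers⇒∤primes n-odd (All.map proj₂ factors)
  above2 : AllPairs _<_ (2 ∷ ps)
  above2 = Allₚ.map⁺ (All.zipWith (λ ((pp , _) , p-odd) → oddPrime>2 pp p-odd) (factors , odd))
           ∷ Linked.Linked⇒AllPairs <-trans (Linked.map⁺ increasing)
  powerful : All PowerfulPrimePower fs
  powerful = All.zipWith
    (λ {pa} ((pp , a≥1) , p-odd , σ[p^a]-prime) → pp , exponent≥2 (proj₂ pa) pp p-odd a≥1 σ[p^a]-prime)
    (factors , All.zip (odd , σ-primes))
  distinct : AllPairs (λ x y → proj₁ x < proj₁ y) fs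
  distinct = Linked.Linked⇒AllPairs <-trans increasing
  excess : 2 * n < product (map (_+ 1) (map (σ ∘ ppow) fs))
  excess = begin-strict
    2 * n                                     <⟨ m<m+n (2 * n) d≥1 ⟩
    2 * n + d                                 ≡⟨ near-superperfect ⟩
    σ (σ n)                                   ≡⟨ cong σ (σ-product-prime-powers distinct (All.map proj₁ factors)) ⟩
    σ (product (map (σ ∘ ppow) fs))           ≤⟨ σ-product-primes (Allₚ.map⁺ σ-primes) ⟩
    product (map (_+ 1) (map (σ ∘ ppow) fs))  ∎
    where open ≤-Reasoning
  ratio>2 : RatioProduct>2 ps
  ratio>2 = excess⇒ratio>2 powerful excess
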